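{- $\mathbf{LogDCFL}\subseteq\mathbf{SLogCFL}\subseteq\mathbf{LogCFL}$.
   Context: $\mathbf{LogCFL}$ (resp. $\mathbf{LogDCFL}$) is the class of languages logspace-reducible to a context-free (resp. deterministic context-free) language; equivalently, languages accepted by nondeterministic (resp. deterministic) auxiliary pushdown automata with $O(\log n)$ space and polynomial time. An auxiliary pushdown automaton (AuxPDA) is a multi-tape Turing machine with a two-way read-only input tape, $l$ tapes including work tapes, and a pushdown tape; space counts only work-tape cells. Its transitions are tuples $(p,\mathcal{S},t_1,\dots,t_l,q)$ with states $p,q$, a stack triple $\mathcal{S}$ and tape triples $t_i$. A tape triple is either $(ab,D,cd)$ with tape symbols $a,b,c,d$ and $D\in\{+1,-1\}$ (for $D=+1$: if the head scans $a$ and the cell to its right holds $b$, rewrite them as $c,d$ and move right; for $D=-1$: the scanned symbol is $b$ with $a$ to its left, rewritten as $d$ and $c$ respectively, and the head moves left), or $(a,0,b)$ (replace scanned $a$ by $b$ without moving). A stack triple is either $(\alpha_a\alpha_b,P,\alpha_c\alpha_d)$ with pushdown symbols and $P\in\{+1,-1\}$ ($+1$ a push, $-1$ a pop, defined analogously) or $(\alpha_a,0,\alpha_b)$. The inverse of $\delta=(p,\mathcal{S},t_1,\dots,t_l,q)$ is $\delta^{ -1}=(q,\mathcal{S}^{ -1},t_1^{ -1},\dots,t_l^{ -1},p)$, where $(x,D,y)^{ -1}=(y,-D,x)$. An AuxPDA is symmetric if its set of transitions is closed under taking inverses. $\mathbf{SLogCFL}$ is the class of languages accepted by $O(\log n)$-space-bounded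 and polynomial-time-bounded symmetric AuxPDAs. -}

module Defs where

open import Data.Nat using (ℕ; zero; suc; _+_; _*_; _^_; _≤_)
open import Data.Nat.Logarithm using (⌊log₂_⌋)
open import Data.Fin using (Fin; zero; suc; fromℕ<)
open import Data.List using (List; []; _∷_; length)
open import Data.List.Membership.Propositional using (_∈_)
open import Data.Vec using (Vec; []; _∷_; map; replicate)
open import Data.Maybe using (Maybe; just; nothing)
open import Data.Bool using (Bool; true)
open import Data.Product using (Σ; _×_; _,_)
open import Relation.Binary.PropositionalEquality using (_≡_)

Language : ℕ → Set₁
Language s = List (Fin s) → Set

-- direction / push-pop indicator  +1 , -1
data Move : Set where
  fwd bwd : Move

negMove : Move → Move
negMove fwd = bwd
negMove bwd = fwd

-- mv a b D c d  is  (ab, D, cd);   stay a b  is  (a, 0, b)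
data Triple (A : Set) : Set where
  mv   : A → A → Move → A → A → Triple A
  stay : A → A → Triple A

invTriple : {A : Set} → Triple A → Triple A
invTriple (mv a b D c d) = mv c d (negMove D) a b
invTriple (stay a b)     = stay b a

data ISym (s : ℕ) : Set where
  lend rend : ISym s
  ch        : Fin s → ISym s

data SCell (d : ℕ) : Set where
  blank : SCell d
  sym   : Fin d → SCell d

-- work-tape alphabet Fin (suc g), blank symbol = zero
WSym : ℕ → Set
WSym g = Fin (suc g)

record Transition (s Q g d k : ℕ) : Set where
  constructor trans
  field
    from  : Fin Q
    stk   : Triple (SCell d)
    inp   : Triple (ISym s)
    wrk   : Vec (Triple (WSym g)) k
    to    : Fin Q

invTransition : ∀ {s Q g d k} → Transition s Q g d k → Transition s Q g d k
invTransition (trans p S t ts q) =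
  trans q (invTriple S) (invTriple t) (map invTriple ts) p

-- Auxiliary pushdown automata over input alphabet Fin s
-- (two-way read-only input tape, k work tapes, one pushdown)

record AuxPDA (s : ℕ) : Set where
  field
    Q g d k   : ℕ
    start     : Fin Q
    accepting : Fin Q → Bool
    δs        : List (Transition s Q g d k)

-- one-way infinite work tape: cells left of head (reversed), scanned
-- cell, cells right of head; all further cells are blank (never visited)
record WTape (g : ℕ) : Set where
  constructor wt
  field
    left  : List (WSym g)
    head  : WSym g
    right : List (WSym g)

cells : ∀ {g} → WTape g → ℕ
cells (wt L a R) = length L + 1 + length R

blankTape : ∀ {g} → WTape g
blankTape = wt [] zero []

record Config {s : ℕ} (M : AuxPDA s) : Set where
  constructor cfg
  open AuxPDA M
  field
    state  : Fin Q
    ipos   : ℕ                      -- input head position (0 = left endmarker)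
    below  : List (SCell d)         -- pushdown contents below the top cell (top first)
    top    : SCell d
    tapes  : Vec (WTape g) k

-- space = work-tape cells used (the pushdown and input are not counted)
spaceW : ∀ {g k} → Vec (WTape g) k → ℕ
spaceW []       = 0
spaceW (t ∷ ts) = cells t + spaceW ts

space : ∀ {s} {M : AuxPDA s} → Config M → ℕ
space c = spaceW (Config.tapes c)

-- Input tape contents:  ⊢ w ⊣  at positions 0 … |w|+1

readIn : ∀ {s} → List (Fin s) → ℕ → Maybe (ISym s)
readIn w zero = just lend
readIn [] (suc zero) = just rend
readIn [] (suc (suc i)) = nothing
readIn (x ∷ w) (suc zero) = just (ch x)
readIn (x ∷ w) (suc (suc i)) = readIn w (suc i)

data IStep {s : ℕ} (w : List (Fin s)) : Triple (ISym s) → ℕ → ℕ → Set where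
  i-fwd  : ∀ {a b i} → readIn w i ≡ just a → readIn w (suc i) ≡ just b →
           IStep w (mv a b fwd a b) i (suc i)
  i-bwd  : ∀ {a b i} → readIn w i ≡ just a → readIn w (suc i) ≡ just b →
           IStep w (mv a b bwd a b) (suc i) i
  i-stay : ∀ {a i} → readIn w i ≡ just a → IStep w (stay a a) i i

data WStep {g : ℕ} : Triple (WSym g) → WTape g → WTape g → Set where
  w-fwd     : ∀ {a b c d L R} →
              WStep (mv a b fwd c d) (wt L a (b ∷ R)) (wt (c ∷ L) d R)
  w-fwd-new : ∀ {a c d L} →          -- the cell to the right is a fresh blank
              WStep (mv a zero fwd c d) (wt L a []) (wt (c ∷ L) d [])
  w-bwd     : ∀ {a b c d L R} →
              WStep (mv a b bwd c d) (wt (a ∷ L) b R) (wt L c (d ∷ R))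
  w-stay    : ∀ {a b L R} → WStep (stay a b) (wt L a R) (wt L b R)

data WSteps {g : ℕ} : ∀ {k} → Vec (Triple (WSym g)) k →
                      Vec (WTape g) k → Vec (WTape g) k → Set where
  []  : WSteps [] [] []
  _∷_ : ∀ {k t x y} {ts : Vec _ k} {xs ys} →
        WStep t x y → WSteps ts xs ys → WSteps (t ∷ ts) (x ∷ xs) (y ∷ ys)

-- pushdown moves on (below , top); cells above the top are blank.
-- push (αa αb, +1, αc αd): top αa, cell above blank; rewrite to αc, push αd.
-- pop  (αa αb, -1, αc αd): top αb over αa; αb becomes αd (must be blank,
-- i.e. the cell is vacated) and αa becomes αc, the new top.
data SStep {d : ℕ} : Triple (SCell d) →
                     List (SCell d) × SCell d → List (SCell d) × SCell d → Set where
  s-push : ∀ {a c e B} → SStep (mv a blank fwd c e) (B , a) (c ∷ B , e)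
  s-pop  : ∀ {a b c B} → SStep (mv a b bwd c blank) (a ∷ B , b) (B , c)
  s-stay : ∀ {a b B} → SStep (stay a b) (B , a) (B , b)

module _ {s : ℕ} (M : AuxPDA s) where
  open AuxPDA M

  StepVia : List (Fin s) → Transition s Q g d k → Config M → Config M → Set
  StepVia w δ (cfg p i B α ts) (cfg q j B' α' ts') =
    Transition.from δ ≡ p × Transition.to δ ≡ q ×
    SStep (Transition.stk δ) (B , α) (B' , α') ×
    IStep w (Transition.inp δ) i j ×
    WSteps (Transition.wrk δ) ts ts'

  Step : List (Fin s) → Config M → Config M → Set
  Step w C C' = Σ (Transition s Q g d k) λ δ → δ ∈ δs × StepVia w δ C C'

  Applicable : List (Fin s) → Transition s Q g d k → Config M → Set
  Applicable w δ C = Σ (Config M) λ C' → StepVia w δ C C'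

  Deterministic : Set
  Deterministic = ∀ (w : List (Fin s)) (C : Config M) δ₁ δ₂ →
    δ₁ ∈ δs → δ₂ ∈ δs → Applicable w δ₁ C → Applicable w δ₂ C → δ₁ ≡ δ₂

  Symmetric : Set
  Symmetric = ∀ δ → δ ∈ δs → invTransition δ ∈ δs

  initial : Config M
  initial = cfg start 0 [] blank (replicate k blankTape)

  data AccRun (w : List (Fin s)) (S : ℕ) : ℕ → Config M → Set where
    done : ∀ {t C} → space C ≤ S → accepting (Config.state C) ≡ true →
           AccRun w S t C
    step : ∀ {t C C'} → space C ≤ S → Step w C C' → AccRun w S t C' →
           AccRun w S (suc t) C

  AcceptsLogPoly : Language s → Set
  AcceptsLogPoly L = Σ ℕ λ c → Σ ℕ λ e → ∀ w →
    let n = length w in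
    (L w → AccRun w (c * suc ⌊log₂ n ⌋) (c * n ^ e + c) initial) ×
    (AccRun w (c * suc ⌊log₂ n ⌋) (c * n ^ e + c) initial → L w)

LogCFL : ∀ {s} → Language s → Set
LogCFL {s} L = Σ (AuxPDA s) λ M → AcceptsLogPoly M L

LogDCFL : ∀ {s} → Language s → Set
LogDCFL {s} L = Σ (AuxPDA s) λ M → Deterministic M × AcceptsLogPoly M L

SLogCFL : ∀ {s} → Language s → Set
SLogCFL {s} L = Σ (AuxPDA s) λ M → Symmetric M × AcceptsLogPoly M L

-- Keep the transitions of the deterministic machine M that leave a non-accepting
-- state and add their inverses; the result M⁺ is symmetric.  An accepting run of
-- M, cut at its first accepting configuration, is a run of M⁺.  Conversely, a run
-- of M⁺ is turned into a run of M from its end backwards: after an inverse step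
-- δ⁻¹ : C ⊢ C′ the configuration C′ is in the source state of δ, hence not
-- accepting, so the converted run from C′ starts with a step of M, which by
-- determinism is δ and returns to C; the two steps cancel.  The return is only up
-- to blank cells appended to a work tape (undoing a move onto a fresh cell keeps
-- that cell), which the run from C does not need.
module Submission where

open import Defs
open import Algebra.Definitions using (Involutive)
open import Data.Bool using (true; false; _≟_)
open import Data.Fin using (Fin; zero)
open import Data.List using (List; []; _∷_; length; filter; _++_)
import Data.List as List
open import Data.List.Membership.Propositional using (_∈_)
open import Data.List.Membership.Propositional.Properties
  using (∈-++⁻; ∈-++⁺ˡ; ∈-++⁺ʳ; ∈-map⁺; ∈-map⁻; ∈-filter⁺; ∈-filter⁻)
open import Data.Nat using (ℕ; suc; _+_; _≤_; z≤n; s≤s)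
open import Data.Nat.Properties using (≤-trans; +-mono-≤; +-monoʳ-≤; m≤n⇒m≤1+n; n≤1+n)
open import Data.Product using (Σ; _×_; _,_; proj₁; proj₂)
open import Data.Sum using (_⊎_; inj₁; inj₂)
open import Data.Vec using (Vec; []; _∷_; map)
open import Data.Vec.Properties using (map-∘; map-cong; map-id)
open import Data.Vec.Relation.Binary.Pointwise.Inductive using (Pointwise; []; _∷_)
open import Relation.Unary using (Decidable)
open import Relation.Binary.PropositionalEquality
  using (_≡_; refl; cong; cong₂; module ≡-Reasoning)
  renaming (sym to ≡-sym; trans to ≡-trans)

negMove-involutive : Involutive _≡_ negMove
negMove-involutive fwd = refl
negMove-involutive bwd = refl

invTriple-involutive : ∀ {A : Set} → Involutive _≡_ (invTriple {A})
invTriple-involutive (mv a b D c d) rewrite negMove-involutive D = refl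
invTriple-involutive (stay a b)     = refl

map-involutive : ∀ {A : Set} {n} {f : A → A} → Involutive _≡_ f → Involutive _≡_ (map {n = n} f)
map-involutive {f = f} f-inv xs = begin
  map f (map f xs)        ≡⟨ map-∘ f f xs ⟨
  map (λ x → f (f x)) xs  ≡⟨ map-cong f-inv xs ⟩
  map (λ x → x) xs        ≡⟨ map-id xs ⟩
  xs                      ∎
  where open ≡-Reasoning

invTransition-involutive : ∀ {s Q g d k} → Involutive _≡_ (invTransition {s} {Q} {g} {d} {k})
invTransition-involutive (trans p S t ts q) = ≡-trans
  (cong₂ (λ S′ t′ → trans p S′ t′ _ q) (invTriple-involutive S) (invTriple-involutive t))
  (cong (λ ts′ → trans p S t ts′ q) (map-involutive invTriple-involutive ts))

++-map-closed : ∀ {A : Set} {f : A → A} → Involutive _≡_ f →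
                ∀ xs {x} → x ∈ xs ++ List.map f xs → f x ∈ xs ++ List.map f xs
++-map-closed {f = f} f-inv xs x∈ with ∈-++⁻ xs x∈
... | inj₁ x∈xs = ∈-++⁺ʳ xs (∈-map⁺ f x∈xs)
... | inj₂ x∈fxs with ∈-map⁻ f x∈fxs
...   | y , y∈xs , refl rewrite f-inv y = ∈-++⁺ˡ y∈xs

SStep-functional : ∀ {d} {t : Triple (SCell d)} {x y z} → SStep t x y → SStep t x z → y ≡ z
SStep-functional s-push s-push = refl
SStep-functional s-pop  s-pop  = refl
SStep-functional s-stay s-stay = refl

IStep-functional : ∀ {s} {w : List (Fin s)} {t i j j′} → IStep w t i j → IStep w t i j′ → j ≡ j′
IStep-functional (i-fwd _ _) (i-fwd _ _) = refl
IStep-functional (i-bwd _ _) (i-bwd _ _) = refl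
IStep-functional (i-stay _)  (i-stay _)  = refl

WStep-functional : ∀ {g} {t : Triple (WSym g)} {x y z} → WStep t x y → WStep t x z → y ≡ z
WStep-functional w-fwd     w-fwd     = refl
WStep-functional w-fwd-new w-fwd-new = refl
WStep-functional w-bwd     w-bwd     = refl
WStep-functional w-stay    w-stay    = refl

WSteps-functional : ∀ {g k} {ts : Vec (Triple (WSym g)) k} {xs ys zs} →
                    WSteps ts xs ys → WSteps ts xs zs → ys ≡ zs
WSteps-functional []       []       = refl
WSteps-functional (a ∷ as) (b ∷ bs) = cong₂ _∷_ (WStep-functional a b) (WSteps-functional as bs)

SStep-inverse : ∀ {d} (t : Triple (SCell d)) {x y} → SStep (invTriple t) x y → SStep t y x
SStep-inverse (mv _ _ fwd _ _) s-pop  = s-push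
SStep-inverse (mv _ _ bwd _ _) s-push = s-pop
SStep-inverse (stay _ _)       s-stay = s-stay

IStep-inverse : ∀ {s} {w : List (Fin s)} (t : Triple (ISym s)) {i j} →
                IStep w (invTriple t) i j → IStep w t j i
IStep-inverse (mv _ _ fwd _ _) (i-bwd p q) = i-fwd p q
IStep-inverse (mv _ _ bwd _ _) (i-fwd p q) = i-bwd p q
IStep-inverse (stay _ _)       (i-stay p)  = i-stay p

data BlankExtension {g : ℕ} : List (WSym g) → List (WSym g) → Set where
  []    : BlankExtension [] []
  blank : ∀ {R} → BlankExtension [] R → BlankExtension [] (zero ∷ R)
  _∷_   : ∀ x {R R′} → BlankExtension R R′ → BlankExtension (x ∷ R) (x ∷ R′)

BlankExtension-refl : ∀ {g} (R : List (WSym g)) → BlankExtension R R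
BlankExtension-refl []      = []
BlankExtension-refl (x ∷ R) = x ∷ BlankExtension-refl R

BlankExtension-length : ∀ {g} {R R′ : List (WSym g)} → BlankExtension R R′ → length R ≤ length R′
BlankExtension-length []        = z≤n
BlankExtension-length (blank e) = m≤n⇒m≤1+n (BlankExtension-length e)
BlankExtension-length (x ∷ e)   = s≤s (BlankExtension-length e)

data _≼_ {g : ℕ} : WTape g → WTape g → Set where
  extend : ∀ {L a R R′} → BlankExtension R R′ → wt L a R ≼ wt L a R′

≼-refl : ∀ {g} {x : WTape g} → x ≼ x
≼-refl {x = wt L a R} = extend (BlankExtension-refl R)

spaceW-mono : ∀ {g k} {xs ys : Vec (WTape g) k} → Pointwise _≼_ xs ys → spaceW xs ≤ spaceW ys
spaceW-mono []                      = z≤n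
spaceW-mono (extend {L = L} e ∷ es) =
  +-mono-≤ (+-monoʳ-≤ (length L + 1) (BlankExtension-length e)) (spaceW-mono es)

WStep-inverse : ∀ {g} (t : Triple (WSym g)) {x y} → WStep (invTriple t) x y →
                Σ (WTape g) λ z → WStep t y z × x ≼ z
WStep-inverse (mv _ _ fwd _ _) w-bwd     = _ , w-fwd , ≼-refl
WStep-inverse (mv _ _ bwd _ _) w-fwd     = _ , w-bwd , ≼-refl
WStep-inverse (mv _ _ bwd _ _) w-fwd-new = _ , w-bwd , extend (blank [])
WStep-inverse (stay _ _)       w-stay    = _ , w-stay , ≼-refl

WSteps-inverse : ∀ {g k} (ts : Vec (Triple (WSym g)) k) {xs ys} → WSteps (map invTriple ts) xs ys →
                 Σ (Vec (WTape g) k) λ zs → WSteps ts ys zs × Pointwise _≼_ xs zs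
WSteps-inverse []       []       = [] , [] , []
WSteps-inverse (t ∷ ts) (a ∷ as) with WStep-inverse t a | WSteps-inverse ts as
... | z , b , x≼z | zs , bs , xs≼zs = z ∷ zs , b ∷ bs , x≼z ∷ xs≼zs

WStep-≼ : ∀ {g} {t : Triple (WSym g)} {x x′ y′} → x ≼ x′ → WStep t x′ y′ →
          Σ (WTape g) λ y → WStep t x y × y ≼ y′
WStep-≼ (extend (_ ∷ e))   w-fwd     = _ , w-fwd , extend e
WStep-≼ (extend (blank e)) w-fwd     = _ , w-fwd-new , extend e
WStep-≼ (extend [])        w-fwd-new = _ , w-fwd-new , extend []
WStep-≼ (extend e)         w-bwd     = _ , w-bwd , extend (_ ∷ e)
WStep-≼ (extend e)         w-stay    = _ , w-stay , extend e

WSteps-≼ : ∀ {g k} {ts : Vec (Triple (WSym g)) k} {xs xs′ ys′} → Pointwise _≼_ xs xs′ →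
           WSteps ts xs′ ys′ → Σ (Vec (WTape g) k) λ ys → WSteps ts xs ys × Pointwise _≼_ ys ys′
WSteps-≼ []       []       = [] , [] , []
WSteps-≼ (e ∷ es) (a ∷ as) with WStep-≼ e a | WSteps-≼ es as
... | y , b , y≼ | ys , bs , ys≼ = y ∷ ys , b ∷ bs , y≼ ∷ ys≼

module _ {s : ℕ} {M : AuxPDA s} where
  open AuxPDA M

  data _≼ᶜ_ : Config M → Config M → Set where
    extend : ∀ {p i B α ts ts′} → Pointwise _≼_ ts ts′ → cfg p i B α ts ≼ᶜ cfg p i B α ts′

  StepVia-source : ∀ {w δ C C′} → StepVia M w δ C C′ → Transition.from δ ≡ Config.state C
  StepVia-source = proj₁

  StepVia-functional : ∀ {w δ C D D′} → StepVia M w δ C D → StepVia M w δ C D′ → D ≡ D′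
  StepVia-functional (p , q , σ , ι , ω) (p′ , q′ , σ′ , ι′ , ω′)
    with SStep-functional σ σ′ | IStep-functional ι ι′ | WSteps-functional ω ω′ | ≡-trans (≡-sym q) q′
  ... | refl | refl | refl | refl = refl

  StepVia-inverse : ∀ {w} δ {C C′} → StepVia M w (invTransition δ) C C′ →
                    Σ (Config M) λ D → StepVia M w δ C′ D × C ≼ᶜ D
  StepVia-inverse (trans _ S t ts _) (p , q , σ , ι , ω) with WSteps-inverse ts ω
  ... | zs , ω′ , ≼zs = _ , (q , p , SStep-inverse S σ , IStep-inverse t ι , ω′) , extend ≼zs

  data EagerAccRun (w : List (Fin s)) (S : ℕ) : ℕ → Config M → Set where
    done : ∀ {t C} → space C ≤ S → accepting (Config.state C) ≡ true → EagerAccRun w S t C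
    step : ∀ {t C C′} → space C ≤ S → accepting (Config.state C) ≡ false →
           Step M w C C′ → EagerAccRun w S t C′ → EagerAccRun w S (suc t) C

  EagerAccRun⇒AccRun : ∀ {w S t C} → EagerAccRun w S t C → AccRun M w S t C
  EagerAccRun⇒AccRun (done C≤S acc)        = done C≤S acc
  EagerAccRun⇒AccRun (step C≤S _ C⊢C′ run) = step C≤S C⊢C′ (EagerAccRun⇒AccRun run)

  AccRun⇒EagerAccRun : ∀ {w S t C} → AccRun M w S t C → EagerAccRun w S t C
  AccRun⇒EagerAccRun (done C≤S acc) = done C≤S acc
  AccRun⇒EagerAccRun {C = C} (step C≤S C⊢C′ run) with accepting (Config.state C) in acc
  ... | true  = done C≤S acc
  ... | false = step C≤S acc C⊢C′ (AccRun⇒EagerAccRun run)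

  EagerAccRun-mono : ∀ {w S t t′ C} → t ≤ t′ → EagerAccRun w S t C → EagerAccRun w S t′ C
  EagerAccRun-mono _          (done C≤S acc)           = done C≤S acc
  EagerAccRun-mono (s≤s t≤t′) (step C≤S rej C⊢C′ run) = step C≤S rej C⊢C′ (EagerAccRun-mono t≤t′ run)

  EagerAccRun-≼ᶜ : ∀ {w S t C C′} → C ≼ᶜ C′ → EagerAccRun w S t C′ → EagerAccRun w S t C
  EagerAccRun-≼ᶜ (extend ≼ts) (done C′≤S acc) = done (≤-trans (spaceW-mono ≼ts) C′≤S) acc
  EagerAccRun-≼ᶜ (extend ≼ts) (step C′≤S rej (δ , δ∈ , (p , q , σ , ι , ω)) run)
    with WSteps-≼ ≼ts ω
  ... | _ , ω′ , ≼ys =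
    step (≤-trans (spaceW-mono ≼ts) C′≤S) rej (δ , δ∈ , (p , q , σ , ι , ω′)) (EagerAccRun-≼ᶜ (extend ≼ys) run)

module Symmetrization {s : ℕ} (M : AuxPDA s) where
  open AuxPDA M

  live? : Decidable (λ (δ : Transition s Q g d k) → accepting (Transition.from δ) ≡ false)
  live? δ = accepting (Transition.from δ) ≟ false

  live : List (Transition s Q g d k)
  live = filter live? δs

  live⁻ : ∀ {δ} → δ ∈ live → δ ∈ δs × accepting (Transition.from δ) ≡ false
  live⁻ = ∈-filter⁻ live?

  M⁺ : AuxPDA s
  M⁺ = record { Q = Q ; g = g ; d = d ; k = k ; start = start ; accepting = accepting
              ; δs = live ++ List.map invTransition live }

  M⁺-symmetric : Symmetric M⁺
  M⁺-symmetric _ = ++-map-closed invTransition-involutive live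

  embed : Config M → Config M⁺
  embed (cfg p i B α ts) = cfg p i B α ts

  forget : Config M⁺ → Config M
  forget (cfg p i B α ts) = cfg p i B α ts

  EagerAccRun⇒AccRun⁺ : ∀ {w S t C} → EagerAccRun w S t C → AccRun M⁺ w S t (embed C)
  EagerAccRun⇒AccRun⁺ (done C≤S acc) = done C≤S acc
  EagerAccRun⇒AccRun⁺ (step C≤S rej (δ , δ∈ , C⊢C′) run) =
    step C≤S (δ , ∈-++⁺ˡ δ∈live , C⊢C′) (EagerAccRun⇒AccRun⁺ run)
    where
    δ∈live : δ ∈ live
    δ∈live = ∈-filter⁺ live? δ∈ (≡-trans (cong accepting (StepVia-source {M = M} C⊢C′)) rej)

  module _ (det : Deterministic M) where

    cancel-inverse : ∀ {w S t δ C C′} → δ ∈ live → StepVia M w (invTransition δ) C C′ →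
                     EagerAccRun w S t C′ → EagerAccRun w S t C
    cancel-inverse δ∈ (_ , δ↦C′ , _) (done _ acc)
      with ≡-trans (≡-sym acc) (≡-trans (cong accepting (≡-sym δ↦C′)) (proj₂ (live⁻ δ∈)))
    ... | ()
    cancel-inverse {δ = δ} δ∈ C⊢C′ (step _ _ (δ′ , δ′∈ , C′⊢D′) run) with StepVia-inverse δ C⊢C′
    ... | D , C′⊢D , C≼D with det _ _ δ δ′ (proj₁ (live⁻ δ∈)) δ′∈ (D , C′⊢D) (_ , C′⊢D′)
    ... | refl with StepVia-functional C′⊢D C′⊢D′
    ... | refl = EagerAccRun-mono (n≤1+n _) (EagerAccRun-≼ᶜ C≼D run)

    AccRun⁺⇒EagerAccRun : ∀ {w S t C} → AccRun M⁺ w S t C → EagerAccRun w S t (forget C)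
    AccRun⁺⇒EagerAccRun (done C≤S acc) = done C≤S acc
    AccRun⁺⇒EagerAccRun (step C≤S (δ , δ∈ , C⊢C′) run) =
      step⁺ C≤S (∈-++⁻ live δ∈) C⊢C′ (AccRun⁺⇒EagerAccRun run)
      where
      step⁺ : ∀ {w S t δ C C′} → space C ≤ S → δ ∈ live ⊎ δ ∈ List.map invTransition live →
              StepVia M w δ C C′ → EagerAccRun w S t C′ → EagerAccRun w S (suc t) C
      step⁺ C≤S (inj₁ δ∈live) C⊢C′ run =
        step C≤S (≡-trans (cong accepting (≡-sym (StepVia-source {M = M} C⊢C′))) (proj₂ (live⁻ δ∈live)))
             (_ , proj₁ (live⁻ δ∈live) , C⊢C′) run
      step⁺ C≤S (inj₂ δ∈inv) C⊢C′ run with ∈-map⁻ invTransition δ∈inv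
      ... | δ₀ , δ₀∈ , refl = EagerAccRun-mono (n≤1+n _) (cancel-inverse δ₀∈ C⊢C′ run)

    M⁺-accepts : ∀ {L} → AcceptsLogPoly M L → AcceptsLogPoly M⁺ L
    M⁺-accepts (c , e , accepts) = c , e , λ w →
      (λ w∈L → EagerAccRun⇒AccRun⁺ (AccRun⇒EagerAccRun (proj₁ (accepts w) w∈L))) ,
      (λ run → proj₂ (accepts w) (EagerAccRun⇒AccRun (AccRun⁺⇒EagerAccRun run)))

theorem2 : ∀ (s : ℕ) (L : Language s) →
    (LogDCFL L → SLogCFL L) × (SLogCFL L → LogCFL L)
theorem2 s L =
  (λ (M , det , M-accepts) → let open Symmetrization M in M⁺ , M⁺-symmetric , M⁺-accepts det M-accepts) ,
  (λ (M , _ , M-accepts) → M , M-accepts)
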